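{- For every integer $n \geq 5$, Left wins the Forbidden Leaf Variant of the Mixed Deletion Game played on the complete graph $K_n$ regardless of which player moves first.
   Context: The Classic Variant of the Mixed Deletion Game is a two-player combinatorial game between Left and Right played on a finite simple undirected graph; players alternate turns. On her turn Left deletes one vertex together with all edges incident to it; on his turn Right deletes one edge. The game ends when a deletion creates an isolated vertex (a vertex of degree $0$), and the player whose deletion created an isolated vertex loses; thus a legal move is a deletion which does not create an isolated vertex, and a player with no legal move loses. The Forbidden Leaf Variant has the same rules with the additional restriction that Left may not delete a leaf (a vertex of degree $1$). $K_n$ denotes the complete graph on $n$ vertices. -}

module Defs where

open import Data.Nat using (ℕ; zero; suc; _+_)
open import Data.Fin using (Fin)
open import Data.Fin.Properties using (_≟_)
open import Data.Bool using (Bool; true; false; _∧_; _∨_; not; if_then_else_)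
open import Data.List using (List; allFin; map)
open import Data.Nat.ListAction using (sum)
open import Data.Product using (Σ; _×_; _,_)
open import Relation.Nullary using (¬_)
open import Relation.Nullary.Decidable using (⌊_⌋)
open import Relation.Binary.PropositionalEquality using (_≡_)

-- A finite simple graph whose vertices are a subset of Fin n.
-- 'alive v' says whether vertex v is still present; 'adj a b' is the
-- (symmetric, irreflexive) edge relation, only meaningful between alive vertices.
record Graph (n : ℕ) : Set where
  constructor mkGraph
  field
    alive : Fin n → Bool
    adj   : Fin n → Fin n → Bool
open Graph public

_==_ : ∀ {n} → Fin n → Fin n → Bool
a == b = ⌊ a ≟ b ⌋

K : (n : ℕ) → Graph n
K n = mkGraph (λ _ → true) (λ a b → not (a == b))

degree : ∀ {n} → Graph n → Fin n → ℕ
degree {n} G v = sum (map (λ u → if alive G u ∧ adj G v u then 1 else 0) (allFin n))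

NoIsolated : ∀ {n} → Graph n → Set
NoIsolated {n} G = (w : Fin n) → alive G w ≡ true → ¬ (degree G w ≡ 0)

deleteVertex : ∀ {n} → Graph n → Fin n → Graph n
deleteVertex G v = mkGraph (λ w → alive G w ∧ not (w == v)) (adj G)

deleteEdge : ∀ {n} → Graph n → Fin n → Fin n → Graph n
deleteEdge G u v =
  mkGraph (alive G)
          (λ a b → adj G a b ∧ not ((a == u ∧ b == v) ∨ (a == v ∧ b == u)))

LeftMove : ∀ {n} → Graph n → Set
LeftMove {n} G = Σ (Fin n) λ v →
  (alive G v ≡ true) × ¬ (degree G v ≡ 1) × NoIsolated (deleteVertex G v)

RightMove : ∀ {n} → Graph n → Set
RightMove {n} G = Σ (Fin n) λ u → Σ (Fin n) λ v →
  (alive G u ≡ true) × (alive G v ≡ true) × (adj G u v ≡ true)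
  × NoIsolated (deleteEdge G u v)

-- Left has a winning strategy (normal play: a player with no legal move loses)
mutual
  data LeftWinsLeftFirst {n : ℕ} (G : Graph n) : Set where
    leftMoves : (m : LeftMove G) → LeftWinsRightFirst (afterL G m)
              → LeftWinsLeftFirst G

  data LeftWinsRightFirst {n : ℕ} (G : Graph n) : Set where
    rightMoves : ((m : RightMove G) → LeftWinsLeftFirst (afterR G m))
               → LeftWinsRightFirst G

  afterL : ∀ {n} (G : Graph n) → LeftMove G → Graph n
  afterL G (v , _) = deleteVertex G v

  afterR : ∀ {n} (G : Graph n) → RightMove G → Graph n
  afterR G (u , v , _) = deleteEdge G u v

-- Left keeps the graph complete for as long as she can. Moving first she deletes any vertex of K_n,
-- reaching K_(n-1) with Right to move. When Right deletes an edge uv of a complete graph on at least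
-- five vertices, Left deletes u, which again leaves a complete graph, one vertex smaller, with Right
-- to move. On four vertices she deletes a third vertex w instead: what remains is the path u - x - v
-- through the fourth vertex x, each of whose edges ends in a leaf, so any edge Right deletes isolates
-- a vertex and he has no legal move. The legality of Left's moves is a count: in a complete graph
-- every vertex has degree size - 1.
module Submission where

open import Defs
open import Data.Nat using (ℕ; zero; suc; _+_; _≤_; z≤n; s≤s)
open import Data.Nat.Properties using (suc-injective; +-suc)
open import Data.Fin using (Fin; zero; suc)
open import Data.Fin.Properties using (_≟_)
open import Data.Bool using (Bool; true; false; _∧_; _∨_; not; if_then_else_)
open import Data.Bool.Properties
  using (∧-identityʳ; ∧-zeroʳ; ∧-comm; ∧-conicalˡ; ∨-comm; ∨-idem; ∨-identityʳ; ∧-commutativeMonoid)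
open import Algebra.Bundles using (CommutativeMonoid)
open import Algebra.Properties.CommutativeSemigroup (CommutativeMonoid.commutativeSemigroup ∧-commutativeMonoid)
  using (xy∙z≈xz∙y; x∙yz≈xz∙y)
open import Data.List using (allFin; map)
open import Data.List.Properties using (map-cong; map-tabulate)
open import Data.Nat.ListAction using (sum)
open import Data.Product using (Σ; _×_; _,_; proj₁)
open import Data.Sum using (_⊎_; inj₁; inj₂)
open import Data.Empty using (⊥-elim)
open import Function using (_∘_)
open import Relation.Nullary using (¬_; Dec; yes; no)
open import Relation.Nullary.Decidable using (isYes≗does; dec-true; dec-false)
open import Relation.Binary.PropositionalEquality
  using (_≡_; _≢_; refl; sym; trans; cong; cong₂; module ≡-Reasoning)

==-refl : ∀ {n} (a : Fin n) → (a == a) ≡ true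
==-refl a = trans (isYes≗does (a ≟ a)) (dec-true (a ≟ a) refl)

==-false : ∀ {n} {a b : Fin n} → a ≢ b → (a == b) ≡ false
==-false {a = a} {b} a≢b = trans (isYes≗does (a ≟ b)) (dec-false (a ≟ b) a≢b)

==-sym : ∀ {n} (a b : Fin n) → (a == b) ≡ (b == a)
==-sym a b with a ≟ b
... | yes refl = sym (==-refl a)
... | no a≢b = sym (==-false (a≢b ∘ sym))

==-suc : ∀ {n} (a b : Fin n) → (Fin.suc a == suc b) ≡ (a == b)
==-suc a b = trans (isYes≗does (suc a ≟ suc b)) (sym (isYes≗does (a ≟ b)))

indicator : Bool → ℕ
indicator b = if b then 1 else 0

count : ∀ {n} → (Fin n → Bool) → ℕ
count {n} p = sum (map (indicator ∘ p) (allFin n))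

count-cong : ∀ {n} {p q : Fin n → Bool} → (∀ u → p u ≡ q u) → count p ≡ count q
count-cong {n} p≗q = cong sum (map-cong (cong indicator ∘ p≗q) (allFin n))

count-suc : ∀ {n} (p : Fin (suc n) → Bool) → count p ≡ indicator (p zero) + count (p ∘ suc)
count-suc p = cong (λ xs → indicator (p zero) + sum xs)
  (trans (map-tabulate suc (indicator ∘ p)) (sym (map-tabulate (λ u → u) (indicator ∘ p ∘ suc))))

count-remove : ∀ {n} (p : Fin n → Bool) (x : Fin n) → p x ≡ true →
               count p ≡ suc (count (λ y → p y ∧ not (y == x)))
count-remove {suc n} p zero px = begin
  count p
    ≡⟨ count-suc p ⟩
  indicator (p zero) + count (p ∘ suc)
    ≡⟨ cong (λ c → indicator c + count (p ∘ suc)) px ⟩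
  suc (indicator false + count (p ∘ suc))
    ≡⟨ cong suc (cong₂ _+_ (cong indicator (sym (∧-zeroʳ (p zero))))
                           (count-cong (sym ∘ ∧-identityʳ ∘ p ∘ suc))) ⟩
  suc (indicator (p zero ∧ false) + count (λ y → p (suc y) ∧ true))
    ≡⟨ cong suc (count-suc (λ y → p y ∧ not (y == zero))) ⟨
  suc (count (λ y → p y ∧ not (y == zero)))
    ∎
  where open ≡-Reasoning
count-remove {suc n} p (suc x) px = begin
  count p
    ≡⟨ count-suc p ⟩
  indicator (p zero) + count (p ∘ suc)
    ≡⟨ cong (indicator (p zero) +_) (count-remove (p ∘ suc) x px) ⟩
  indicator (p zero) + suc (count (λ y → p (suc y) ∧ not (y == x)))
    ≡⟨ +-suc (indicator (p zero)) _ ⟩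
  suc (indicator (p zero) + count (λ y → p (suc y) ∧ not (y == x)))
    ≡⟨ cong suc (cong₂ _+_ (cong indicator (sym (∧-identityʳ (p zero))))
                           (count-cong (λ y → cong (λ e → p (suc y) ∧ not e) (sym (==-suc y x))))) ⟩
  suc (indicator (p zero ∧ true) + count (λ y → p (suc y) ∧ not (suc y == suc x)))
    ≡⟨ cong suc (count-suc (λ y → p y ∧ not (y == suc x))) ⟨
  suc (count (λ y → p y ∧ not (y == suc x)))
    ∎
  where open ≡-Reasoning

count-witness : ∀ {n} (p : Fin n → Bool) {k} → count p ≡ suc k → Σ (Fin n) (λ y → p y ≡ true)
count-witness {suc n} p cp with p zero in p0 | trans (sym (count-suc p)) cp
... | true  | _   = zero , p0
... | false | cp′ = let y , py = count-witness (p ∘ suc) cp′ in suc y , py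

count-zero : ∀ {n} (p : Fin n → Bool) {x} → count p ≡ 0 → ¬ p x ≡ true
count-zero p {x} cp px with () ← trans (sym cp) (count-remove p x px)

size : ∀ {n} → Graph n → ℕ
size G = count (alive G)

alive-deleteVertex⁺ : ∀ {n} (G : Graph n) {v w} → alive G w ≡ true → w ≢ v →
                      alive (deleteVertex G v) w ≡ true
alive-deleteVertex⁺ G aw w≢v rewrite aw | ==-false w≢v = refl

alive-deleteVertex⁻ : ∀ {n} (G : Graph n) {v w} → alive (deleteVertex G v) w ≡ true →
                      alive G w ≡ true × w ≢ v
alive-deleteVertex⁻ G {v} {w} aw with alive G w | w ≟ v
... | true | no w≢v = refl , w≢v
alive-deleteVertex⁻ G {v} {w} () | true | yes _
alive-deleteVertex⁻ G {v} {w} () | false | _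

size-deleteVertex : ∀ {n} (G : Graph n) {v k} → alive G v ≡ true → size G ≡ suc k →
                    size (deleteVertex G v) ≡ k
size-deleteVertex G {v} av sG = suc-injective (trans (sym (count-remove (alive G) v av)) sG)

size-deleteVertex₂ : ∀ {n} (G : Graph n) {u v k} → alive G u ≡ true → alive G v ≡ true → u ≢ v →
                     size G ≡ 2 + k → size (deleteVertex (deleteVertex G v) u) ≡ k
size-deleteVertex₂ G au av u≢v sG =
  size-deleteVertex (deleteVertex G _) (alive-deleteVertex⁺ G au u≢v) (size-deleteVertex G av sG)

alive-unique : ∀ {n} (G : Graph n) {a b} → size G ≡ 1 → alive G a ≡ true → alive G b ≡ true → a ≡ b
alive-unique G {a} {b} sG aa ab with a ≟ b
... | yes a≡b = a≡b
... | no a≢b = ⊥-elim (count-zero (alive (deleteVertex G a)) (size-deleteVertex G aa sG)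
                                  (alive-deleteVertex⁺ G ab (a≢b ∘ sym)))

third-alive : ∀ {n} (G : Graph n) {u v k} → alive G u ≡ true → alive G v ≡ true → u ≢ v →
              size G ≡ 3 + k → Σ (Fin n) λ w → alive G w ≡ true × w ≢ u × w ≢ v
third-alive G {u} {v} au av u≢v sG
  with count-witness (alive (deleteVertex (deleteVertex G v) u)) (size-deleteVertex₂ G au av u≢v sG)
... | w , aw with alive-deleteVertex⁻ (deleteVertex G v) aw
...   | aw′ , w≢u with alive-deleteVertex⁻ G aw′
...     | aw″ , w≢v = w , aw″ , w≢u , w≢v

degree-deleteVertex : ∀ {n} (G : Graph n) {u v} → alive G v ≡ true → adj G u v ≡ true →
                      degree G u ≡ suc (degree (deleteVertex G v) u)
degree-deleteVertex G {u} {v} av uv =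
  trans (count-remove (λ y → alive G y ∧ adj G u y) v (cong₂ _∧_ av uv))
        (cong suc (count-cong (λ y → xy∙z≈xz∙y (alive G y) (adj G u y) (not (y == v)))))

edge-removed-at : ∀ {n} (u v y : Fin n) → not ((u == u ∧ y == v) ∨ (u == v ∧ y == u)) ≡ not (y == v)
edge-removed-at u v y with u ≟ v
... | yes refl rewrite ==-refl u = cong not (∨-idem (y == u))
... | no u≢v rewrite ==-refl u = cong not (∨-identityʳ (y == v))

degree-deleteEdge : ∀ {n} (G : Graph n) (u v : Fin n) →
                    degree (deleteEdge G u v) u ≡ degree (deleteVertex G v) u
degree-deleteEdge G u v = count-cong λ y →
  trans (cong (λ c → alive G y ∧ (adj G u y ∧ c)) (edge-removed-at u v y))
        (x∙yz≈xz∙y (alive G y) (adj G u y) (not (y == v)))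

degree-deleteEdge-comm : ∀ {n} (G : Graph n) (u v w : Fin n) →
                         degree (deleteEdge G u v) w ≡ degree (deleteEdge G v u) w
degree-deleteEdge-comm G u v w = count-cong λ y →
  cong (λ c → alive G y ∧ (adj G w y ∧ not c)) (∨-comm ((w == u) ∧ (y == v)) ((w == v) ∧ (y == u)))

degree-deleteEdge-other : ∀ {n} (G : Graph n) {u v w} → w ≢ u → w ≢ v →
                          degree (deleteEdge G u v) w ≡ degree G w
degree-deleteEdge-other G {u} {v} {w} w≢u w≢v = count-cong away
  where
  away : ∀ y → (alive G y ∧ (adj G w y ∧ not ((w == u ∧ y == v) ∨ (w == v ∧ y == u))))
             ≡ (alive G y ∧ adj G w y)
  away y rewrite ==-false w≢u | ==-false w≢v = cong (alive G y ∧_) (∧-identityʳ (adj G w y))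

deleteEdge-leaf : ∀ {n} (G : Graph n) {u v} → alive G v ≡ true → adj G u v ≡ true → degree G u ≡ 1 →
                  degree (deleteEdge G u v) u ≡ 0
deleteEdge-leaf G {u} {v} av uv du =
  trans (degree-deleteEdge G u v) (suc-injective (trans (sym (degree-deleteVertex G av uv)) du))

adj-deleteEdge-comm : ∀ {n} (G : Graph n) (u v : Fin n) {a b} → adj G a b ≡ adj G b a →
                      adj (deleteEdge G u v) a b ≡ adj (deleteEdge G u v) b a
adj-deleteEdge-comm G u v {a} {b} ab≡ba = cong₂ _∧_ ab≡ba (cong not (trans
  (∨-comm ((a == u) ∧ (b == v)) ((a == v) ∧ (b == u)))
  (cong₂ _∨_ (∧-comm (a == v) (b == u)) (∧-comm (a == u) (b == v)))))

-- Graph does not force adj to be symmetric; symmetry on the edge lets a leaf at either end be used.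
noRightMove-if-leafEdges : ∀ {n} (G : Graph n) →
  (∀ {a b} → alive G a ≡ true → alive G b ≡ true → adj G a b ≡ adj G b a) →
  (∀ {a b} → alive G a ≡ true → alive G b ≡ true → adj G a b ≡ true →
             degree G a ≡ 1 ⊎ degree G b ≡ 1) →
  ¬ RightMove G
noRightMove-if-leafEdges G adj-comm leaf (a , b , aa , ab , ab-edge , noIso) with leaf aa ab ab-edge
... | inj₁ da = noIso a aa (deleteEdge-leaf G ab ab-edge da)
... | inj₂ db = noIso b ab (trans (degree-deleteEdge-comm G a b b)
                                  (deleteEdge-leaf G aa (trans (adj-comm ab aa) ab-edge) db))

Complete : ∀ {n} → Graph n → Set
Complete {n} G = ∀ {a b : Fin n} → alive G a ≡ true → alive G b ≡ true → adj G a b ≡ not (a == b)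

Complete-K : ∀ n → Complete (K n)
Complete-K n _ _ = refl

size-K : ∀ n → size (K n) ≡ n
size-K zero = refl
size-K (suc n) = trans (count-suc (alive (K (suc n)))) (cong suc (size-K n))

Complete-deleteVertex : ∀ {n} {G : Graph n} {v} → Complete G → Complete (deleteVertex G v)
Complete-deleteVertex {G = G} C aa ab =
  C (proj₁ (alive-deleteVertex⁻ G aa)) (proj₁ (alive-deleteVertex⁻ G ab))

Complete-deleteEdge-deleteVertex : ∀ {n} {G : Graph n} {u v} → Complete G →
                                   Complete (deleteVertex (deleteEdge G u v) u)
Complete-deleteEdge-deleteVertex {G = G} {u} {v} C {a} {b} aa ab
  with alive-deleteVertex⁻ (deleteEdge G u v) aa | alive-deleteVertex⁻ (deleteEdge G u v) ab
... | aa′ , a≢u | ab′ , b≢u rewrite C aa′ ab′ | ==-false a≢u | ==-false b≢u | ∧-zeroʳ (a == v) =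
  ∧-identityʳ (not (a == b))

Complete-adj-comm : ∀ {n} {G : Graph n} → Complete G →
                    ∀ {a b} → alive G a ≡ true → alive G b ≡ true → adj G a b ≡ adj G b a
Complete-adj-comm C {a} {b} aa ab = trans (C aa ab) (trans (cong not (==-sym a b)) (sym (C ab aa)))

Complete-adj⇒≢ : ∀ {n} {G : Graph n} → Complete G →
                 ∀ {a b} → alive G a ≡ true → alive G b ≡ true → adj G a b ≡ true → a ≢ b
Complete-adj⇒≢ C {a} aa _ ab-edge refl
  with () ← trans (sym ab-edge) (trans (C aa aa) (cong not (==-refl a)))

degree-complete : ∀ {n} {G : Graph n} → Complete G →
                  ∀ {v} → alive G v ≡ true → degree G v ≡ size (deleteVertex G v)
degree-complete {G = G} C {v} av = count-cong neighbour
  where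
  neighbour : ∀ y → (alive G y ∧ adj G v y) ≡ (alive G y ∧ not (y == v))
  neighbour y with alive G y in ay
  ... | false = refl
  ... | true = trans (C av ay) (cong not (==-sym v y))

noIsolated-complete : ∀ {n} {G : Graph n} {k} → Complete G → size G ≡ 2 + k → NoIsolated G
noIsolated-complete {G = G} C sG w aw dw
  with () ← trans (sym dw) (trans (degree-complete C aw) (size-deleteVertex G aw sG))

legalLeftMove-complete : ∀ {n} {G : Graph n} {k v} → Complete G → size G ≡ 3 + k → alive G v ≡ true →
                         ¬ degree G v ≡ 1 × NoIsolated (deleteVertex G v)
legalLeftMove-complete {G = G} {v = v} C sG av = not-leaf , noIsolated-complete (Complete-deleteVertex C) sG-v
  where
  sG-v = size-deleteVertex G av sG
  not-leaf : ¬ degree G v ≡ 1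
  not-leaf dv with () ← trans (sym dv) (trans (degree-complete C av) sG-v)

degree-deleteEdge-complete : ∀ {n} {G : Graph n} {k u v} → Complete G → size G ≡ 2 + k →
  alive G u ≡ true → alive G v ≡ true → u ≢ v → degree (deleteEdge G u v) u ≡ k
degree-deleteEdge-complete {G = G} {u = u} {v} C sG au av u≢v = begin
  degree (deleteEdge G u v) u
    ≡⟨ degree-deleteEdge G u v ⟩
  degree (deleteVertex G v) u
    ≡⟨ degree-complete (Complete-deleteVertex C) (alive-deleteVertex⁺ G au u≢v) ⟩
  size (deleteVertex (deleteVertex G v) u)
    ≡⟨ size-deleteVertex₂ G au av u≢v sG ⟩
  _
    ∎
  where open ≡-Reasoning

noIsolated-deleteEdge-complete : ∀ {n} {G : Graph n} {k u v} → Complete G → size G ≡ 3 + k →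
  alive G u ≡ true → alive G v ≡ true → u ≢ v → NoIsolated (deleteEdge G u v)
noIsolated-deleteEdge-complete {G = G} {u = u} {v} C sG au av u≢v z az = nonzero (z ≟ u) (z ≟ v)
  where
  nonzero : Dec (z ≡ u) → Dec (z ≡ v) → ¬ degree (deleteEdge G u v) z ≡ 0
  nonzero (yes refl) _ dz with () ← trans (sym dz) (degree-deleteEdge-complete C sG au av u≢v)
  nonzero (no _) (yes refl) dz with () ← trans (sym dz) (trans (degree-deleteEdge-comm G u v v)
                                                  (degree-deleteEdge-complete C sG av au (u≢v ∘ sym)))
  nonzero (no z≢u) (no z≢v) dz with () ← trans (sym dz) (trans (degree-deleteEdge-other G z≢u z≢v)
                                                 (trans (degree-complete C az) (size-deleteVertex G az sG)))

noRightMove-path : ∀ {n} {G : Graph n} {u v} → Complete G → size G ≡ 3 →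
  alive G u ≡ true → alive G v ≡ true → u ≢ v → ¬ RightMove (deleteEdge G u v)
noRightMove-path {G = G} {u} {v} C sG au av u≢v =
  noRightMove-if-leafEdges H (λ aa ab → adj-deleteEdge-comm G u v (Complete-adj-comm C aa ab)) leafEdge
  where
  H = deleteEdge G u v
  du : degree H u ≡ 1
  du = degree-deleteEdge-complete C sG au av u≢v
  dv : degree H v ≡ 1
  dv = trans (degree-deleteEdge-comm G u v v) (degree-deleteEdge-complete C sG av au (u≢v ∘ sym))
  leafEdge : ∀ {a b} → alive H a ≡ true → alive H b ≡ true → adj H a b ≡ true →
             degree H a ≡ 1 ⊎ degree H b ≡ 1
  leafEdge {a} {b} aa ab ab-edge = leafEnd (a ≟ u) (a ≟ v) (b ≟ u) (b ≟ v)
    where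
    leafEnd : Dec (a ≡ u) → Dec (a ≡ v) → Dec (b ≡ u) → Dec (b ≡ v) →
              degree H a ≡ 1 ⊎ degree H b ≡ 1
    leafEnd (yes refl) _ _ _ = inj₁ du
    leafEnd _ (yes refl) _ _ = inj₁ dv
    leafEnd _ _ (yes refl) _ = inj₂ du
    leafEnd _ _ _ (yes refl) = inj₂ dv
    leafEnd (no a≢u) (no a≢v) (no b≢u) (no b≢v) =
      ⊥-elim (Complete-adj⇒≢ C aa ab (∧-conicalˡ (adj G a b) _ ab-edge)
               (alive-unique (deleteVertex (deleteVertex G v) u) (size-deleteVertex₂ G au av u≢v sG)
                 (alive-deleteVertex⁺ (deleteVertex G v) (alive-deleteVertex⁺ G aa a≢v) a≢u)
                 (alive-deleteVertex⁺ (deleteVertex G v) (alive-deleteVertex⁺ G ab b≢v) b≢u)))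

mutual
  rightFirst-complete : ∀ {n} k (G : Graph n) → Complete G → size G ≡ 4 + k → LeftWinsRightFirst G
  rightFirst-complete k G C sG = rightMoves λ where
    (u , v , au , av , uv , _) → afterEdgeDeletion k G C sG au av (Complete-adj⇒≢ C au av uv)

  afterEdgeDeletion : ∀ {n} k (G : Graph n) {u v} → Complete G → size G ≡ 4 + k →
    alive G u ≡ true → alive G v ≡ true → u ≢ v → LeftWinsLeftFirst (deleteEdge G u v)
  afterEdgeDeletion (suc k) G {u} {v} C sG au av u≢v =
    leftMoves (u , au , not-leaf , noIsolated-complete C′ sG-u) (rightFirst-complete k _ C′ sG-u)
    where
    C′ = Complete-deleteEdge-deleteVertex C
    sG-u = size-deleteVertex G au sG
    not-leaf : ¬ degree (deleteEdge G u v) u ≡ 1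
    not-leaf du with () ← trans (sym du) (degree-deleteEdge-complete C sG au av u≢v)
  afterEdgeDeletion zero G {u} {v} C sG au av u≢v with third-alive G au av u≢v sG
  ... | w , aw , w≢u , w≢v =
    -- deleteVertex (deleteEdge G u v) w is definitionally deleteEdge (deleteVertex G w) u v.
    leftMoves (w , aw , not-leaf , noIsolated-deleteEdge-complete C′ sG-w au′ av′ u≢v)
              (rightMoves λ m → ⊥-elim (noRightMove-path C′ sG-w au′ av′ u≢v m))
    where
    C′ = Complete-deleteVertex C
    sG-w = size-deleteVertex G aw sG
    au′ = alive-deleteVertex⁺ G au (w≢u ∘ sym)
    av′ = alive-deleteVertex⁺ G av (w≢v ∘ sym)
    not-leaf : ¬ degree (deleteEdge G u v) w ≡ 1
    not-leaf dw with () ← trans (sym dw) (trans (degree-deleteEdge-other G w≢u w≢v)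
                                                (trans (degree-complete C aw) sG-w))

leftFirst-complete : ∀ {n} k (G : Graph n) → Complete G → size G ≡ 5 + k → LeftWinsLeftFirst G
leftFirst-complete k G C sG with count-witness (alive G) sG
... | v , av = leftMoves (v , av , legalLeftMove-complete C sG av)
                         (rightFirst-complete k _ (Complete-deleteVertex C) (size-deleteVertex G av sG))

theorem3p13 : (n : ℕ) → 5 ≤ n → LeftWinsLeftFirst (K n) × LeftWinsRightFirst (K n)
theorem3p13 n@(suc (suc (suc (suc (suc k))))) (s≤s (s≤s (s≤s (s≤s (s≤s z≤n))))) =
    leftFirst-complete k (K n) (Complete-K n) (size-K n)
  , rightFirst-complete (suc k) (K n) (Complete-K n) (size-K n)
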